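{- Let $P$ be a decreasing tableau. If $x$ is a $P$-ejectable value, then $\mathrm{row}(P)\equiv_H \mathrm{row}(P)\,x$.
   Context: A decreasing tableau is a filling of the diagram of a partition (English notation) by positive integers strictly decreasing from left to right along rows and from top to bottom along columns. $P_{>r}$ denotes the tableau obtained by deleting the first $r$ rows of $P$. A value $x$ is $P$-ejectable if $x$ occurs in the first row of $P$ and either $x-1$ does not occur in the first row, or $x-1$ occurs in the first row and $x-1$ is $P_{>1}$-ejectable (nothing is ejectable in the empty tableau). The row word $\mathrm{row}(P)$ is $\cdots u^{(2)}u^{(1)}$, where $u^{(j)}$ is row $j$ of $P$ read left to right. Hecke equivalence $\equiv_H$ is the congruence on words in $\mathbb{Z}_{>0}$ generated by $jj\equiv_H j$, $j(j+1)j\equiv_H(j+1)j(j+1)$, and $jk\equiv_H kj$ for $|j-k|\ge 2$. -}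

module Defs where

open import Data.Nat using (ℕ; suc; _<_; _>_; _∸_)
open import Data.List using (List; []; _∷_; _++_; [_]; concat; reverse)
open import Data.List.Relation.Unary.All using (All)
open import Data.List.Relation.Unary.Linked using (Linked)
open import Data.List.Membership.Propositional using (_∈_; _∉_)
open import Data.Product using (_×_)
open import Data.Sum using (_⊎_)
open import Data.Empty using (⊥)
open import Data.Unit using (⊤)

-- A tableau is given by its list of rows (top row first), each row read left to right.
Tableau : Set
Tableau = List (List ℕ)

ColBelow : List ℕ → List ℕ → Set
ColBelow _        []       = ⊤
ColBelow []       (_ ∷ _)  = ⊥
ColBelow (a ∷ as) (b ∷ bs) = b < a × ColBelow as bs

NonEmpty : List ℕ → Set
NonEmpty []      = ⊥
NonEmpty (_ ∷ _) = ⊤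

Columns : Tableau → Set
Columns []             = ⊤
Columns (r ∷ [])       = ⊤
Columns (r ∷ r' ∷ rs)  = ColBelow r r' × Columns (r' ∷ rs)

-- Decreasing tableau: partition shape (nonempty rows of weakly decreasing
-- lengths, enforced by ColBelow), positive integer entries, strictly
-- decreasing along rows (left to right) and columns (top to bottom).
IsDecreasingTableau : Tableau → Set
IsDecreasingTableau P =
  All NonEmpty P × All (All (0 <_)) P × All (Linked _>_) P × Columns P

-- x is P-ejectable (P_{>1} is the tail of the list of rows).
Ejectable : Tableau → ℕ → Set
Ejectable []       x = ⊥
Ejectable (r ∷ rs) x =
  x ∈ r × ((x ∸ 1) ∉ r ⊎ ((x ∸ 1) ∈ r × Ejectable rs (x ∸ 1)))

-- row(P) = ... u⁽²⁾ u⁽¹⁾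
rowWord : Tableau → List ℕ
rowWord P = concat (reverse P)

data _≡H_ : List ℕ → List ℕ → Set where
  H-refl  : ∀ {w} → w ≡H w
  H-sym   : ∀ {w w'} → w ≡H w' → w' ≡H w
  H-trans : ∀ {w w' w''} → w ≡H w' → w' ≡H w'' → w ≡H w''
  H-idem  : ∀ u v j → (u ++ j ∷ j ∷ v) ≡H (u ++ j ∷ v)
  H-braid : ∀ u v j → (u ++ j ∷ suc j ∷ j ∷ v) ≡H (u ++ suc j ∷ j ∷ suc j ∷ v)
  H-comm  : ∀ u v j k → suc j < k → (u ++ j ∷ k ∷ v) ≡H (u ++ k ∷ j ∷ v)

-- In a strictly decreasing row r containing x, write r = u x v with u > x > v.
-- If x − 1 is absent, every letter of v differs from x by at least 2, so the
-- appended x commutes leftwards to meet x and is absorbed: r x ≡H r.  If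
-- x − 1 = y is present it must directly follow x, and r x = u (y+1) y v (y+1)
-- ≡H u y (y+1) y v ≡H y r, by commuting y+1 past v, a braid move, and
-- commuting y past u.  Since row(P) = row(P_{>1}) r, the y emitted to the left
-- of r is absorbed by row(P_{>1}), by induction on the rows of P.
module Submission where

open import Defs
open import Data.Nat using (ℕ; zero; suc; _<_; _>_; _∸_; s≤s)
open import Data.Nat.Properties using (<-trans; <-asym; <⇒≱; ≤∧≢⇒<; n<1+n)
open import Data.List using (List; []; _∷_; _++_; [_]; concat; reverse)
open import Data.List.Properties using (++-assoc; ++-identityʳ; concat-++; unfold-reverse)
open import Data.List.Relation.Unary.All as All using (All; []; _∷_)
open import Data.List.Relation.Unary.Any using (here; there)
open import Data.List.Relation.Unary.Linked as Linked using (Linked; []; [-]; _∷_)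
open import Data.List.Relation.Unary.Linked.Properties using (Linked⇒All)
open import Data.List.Membership.Propositional using (_∈_; _∉_)
open import Data.List.Membership.Propositional.Properties using (∈-++⁻; ∈-++⁺ʳ)
open import Data.Product using (_×_; _,_; ∃; ∃₂)
open import Data.Sum using (_⊎_; inj₁; inj₂)
open import Data.Empty using (⊥-elim)
open import Relation.Binary.Bundles using (Setoid)
open import Relation.Binary.PropositionalEquality using (_≡_; _≢_; refl; cong; subst₂; module ≡-Reasoning)
open import Relation.Nullary using (¬_)
import Relation.Binary.Reasoning.Setoid as SetoidReasoning

≡H-setoid : Setoid _ _
≡H-setoid = record
  { Carrier       = List ℕ
  ; _≈_           = _≡H_
  ; isEquivalence = record { refl = H-refl ; sym = H-sym ; trans = H-trans }
  }

reassociate : ∀ (a b u m v : List ℕ) → (a ++ u) ++ m ++ v ++ b ≡ a ++ (u ++ m ++ v) ++ b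
reassociate a b u m v = begin
  (a ++ u) ++ m ++ v ++ b   ≡⟨ ++-assoc a u _ ⟩
  a ++ u ++ m ++ v ++ b     ≡⟨ cong (λ t → a ++ u ++ t) (++-assoc m v b) ⟨
  a ++ u ++ (m ++ v) ++ b   ≡⟨ cong (a ++_) (++-assoc u (m ++ v) b) ⟨
  a ++ (u ++ m ++ v) ++ b   ∎
  where open ≡-Reasoning

relation-in-context : ∀ a b u v m m' →
  ((a ++ u) ++ m ++ v ++ b) ≡H ((a ++ u) ++ m' ++ v ++ b) →
  (a ++ (u ++ m ++ v) ++ b) ≡H (a ++ (u ++ m' ++ v) ++ b)
relation-in-context a b u v m m' = subst₂ _≡H_ (reassociate a b u m v) (reassociate a b u m' v)

++-cong : ∀ a b {w w'} → w ≡H w' → (a ++ w ++ b) ≡H (a ++ w' ++ b)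
++-cong a b H-refl              = H-refl
++-cong a b (H-sym p)           = H-sym (++-cong a b p)
++-cong a b (H-trans p q)       = H-trans (++-cong a b p) (++-cong a b q)
++-cong a b (H-idem u v j)      =
  relation-in-context a b u v (j ∷ j ∷ []) [ j ] (H-idem (a ++ u) (v ++ b) j)
++-cong a b (H-braid u v j)     =
  relation-in-context a b u v (j ∷ suc j ∷ j ∷ []) (suc j ∷ j ∷ suc j ∷ []) (H-braid (a ++ u) (v ++ b) j)
++-cong a b (H-comm u v j k lt) =
  relation-in-context a b u v (j ∷ k ∷ []) (k ∷ j ∷ []) (H-comm (a ++ u) (v ++ b) j k lt)

++-congˡ : ∀ a {w w'} → w ≡H w' → (a ++ w) ≡H (a ++ w')
++-congˡ a {w} {w'} p =
  subst₂ (λ s t → (a ++ s) ≡H (a ++ t)) (++-identityʳ w) (++-identityʳ w') (++-cong a [] p)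

++-congʳ : ∀ b {w w'} → w ≡H w' → (w ++ b) ≡H (w' ++ b)
++-congʳ b = ++-cong [] b

Distant : ℕ → ℕ → Set
Distant j k = suc j < k ⊎ suc k < j

distant-comm : ∀ {j k} → Distant j k → ∀ u v → (u ++ j ∷ k ∷ v) ≡H (u ++ k ∷ j ∷ v)
distant-comm {j} {k} (inj₁ j+1<k) u v = H-comm u v j k j+1<k
distant-comm {j} {k} (inj₂ k+1<j) u v = H-sym (H-comm u v k j k+1<j)

commute-through : ∀ {x} w → All (Distant x) w → (x ∷ w) ≡H (w ++ [ x ])
commute-through []      []       = H-refl
commute-through (a ∷ w) (d ∷ ds) = H-trans (distant-comm d [] w) (++-congˡ [ a ] (commute-through w ds))

head-dominates : ∀ {a r} → Linked _>_ (a ∷ r) → All (_< a) r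
head-dominates [-]        = []
head-dominates (a>b ∷ lr) = Linked⇒All (λ p q → <-trans q p) a>b lr

split-decreasing : ∀ {x r} → Linked _>_ r → x ∈ r →
  ∃₂ λ u v → r ≡ u ++ x ∷ v × All (x <_) u × Linked _>_ (x ∷ v)
split-decreasing lr (here refl) = [] , _ , refl , [] , lr
split-decreasing lr (there x∈r) with split-decreasing (Linked.tail lr) x∈r
... | u , v , refl , x<u , lv = _ ∷ u , v , refl , All.lookup (head-dominates lr) x∈r ∷ x<u , lv

<∧≢pred⇒suc< : ∀ {z x} → z < x → z ≢ x ∸ 1 → suc z < x
<∧≢pred⇒suc< z<x z≢x-1 = ≤∧≢⇒< z<x (λ { refl → z≢x-1 refl })

row-absorbs : ∀ {x r} → Linked _>_ r → x ∈ r → x ∸ 1 ∉ r → (r ++ [ x ]) ≡H r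
row-absorbs {x} lr x∈r x-1∉r with split-decreasing lr x∈r
... | u , v , refl , _ , lv = begin
  (u ++ x ∷ v) ++ [ x ]  ≡⟨ ++-assoc u (x ∷ v) [ x ] ⟩
  u ++ x ∷ v ++ [ x ]    ≈⟨ ++-congˡ u (++-congˡ [ x ] (H-sym (commute-through v v-distant))) ⟩
  u ++ x ∷ x ∷ v         ≈⟨ H-idem u v x ⟩
  u ++ x ∷ v             ∎
  where
  open SetoidReasoning ≡H-setoid
  v-distant : All (Distant x) v
  v-distant = All.tabulate λ z∈v →
    inj₂ (<∧≢pred⇒suc< (All.lookup (head-dominates lv) z∈v) λ { refl → x-1∉r (∈-++⁺ʳ u (there z∈v)) })

pred-follows : ∀ {y v} → Linked _>_ (suc y ∷ v) → y ∈ v → ∃ λ v' → v ≡ y ∷ v'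
pred-follows (_ ∷ _)        (here refl) = _ , refl
pred-follows (s≤s h≤y ∷ lv) (there y∈v) = ⊥-elim (<⇒≱ (All.lookup (head-dominates lv) y∈v) h≤y)

∈-after-suc : ∀ {y} u {v} → All (suc y <_) u → y ∈ u ++ suc y ∷ v → y ∈ v
∈-after-suc {y} u y+1<u y∈r with ∈-++⁻ u y∈r
... | inj₁ y∈u         = ⊥-elim (<-asym (n<1+n y) (All.lookup y+1<u y∈u))
... | inj₂ (there y∈v) = y∈v

row-shifts : ∀ {y r} → Linked _>_ r → suc y ∈ r → y ∈ r → (r ++ [ suc y ]) ≡H (y ∷ r)
row-shifts {y} lr y+1∈r y∈r with split-decreasing lr y+1∈r
... | u , v , refl , y+1<u , lv with pred-follows lv (∈-after-suc u y+1<u y∈r)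
... | v' , refl = begin
  (u ++ suc y ∷ y ∷ v') ++ [ suc y ]  ≡⟨ ++-assoc u _ [ suc y ] ⟩
  u ++ suc y ∷ y ∷ v' ++ [ suc y ]    ≈⟨ ++-congˡ u (++-congˡ (suc y ∷ y ∷ []) (H-sym (commute-through v' v'-distant))) ⟩
  u ++ suc y ∷ y ∷ suc y ∷ v'         ≈⟨ H-braid u v' y ⟨
  u ++ y ∷ suc y ∷ y ∷ v'             ≡⟨ ++-assoc u [ y ] _ ⟨
  (u ++ [ y ]) ++ suc y ∷ y ∷ v'      ≈⟨ ++-congʳ _ (commute-through u (All.map inj₁ y+1<u)) ⟨
  y ∷ u ++ suc y ∷ y ∷ v'             ∎
  where
  open SetoidReasoning ≡H-setoid
  v'-distant : All (Distant (suc y)) v'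
  v'-distant = All.map (λ z<y → inj₂ (s≤s z<y)) (head-dominates (Linked.tail lv))

rowWord-∷ : ∀ r rs → rowWord (r ∷ rs) ≡ rowWord rs ++ r
rowWord-∷ r rs = begin
  concat (reverse (r ∷ rs))          ≡⟨ cong concat (unfold-reverse r rs) ⟩
  concat (reverse rs ++ [ r ])       ≡⟨ concat-++ (reverse rs) [ r ] ⟨
  concat (reverse rs) ++ (r ++ [])   ≡⟨ cong (concat (reverse rs) ++_) (++-identityʳ r) ⟩
  concat (reverse rs) ++ r           ∎
  where open ≡-Reasoning

-- Since 0 ∸ 1 = 0, ejectability of 0 would have to recur through every row.
¬Ejectable-0 : ∀ P → ¬ Ejectable P 0
¬Ejectable-0 (r ∷ rs) (0∈r , inj₁ 0∉r)      = 0∉r 0∈r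
¬Ejectable-0 (r ∷ rs) (_   , inj₂ (_ , e)) = ¬Ejectable-0 rs e

ejectable-absorbed : ∀ {P x} → All (Linked _>_) P → Ejectable P x → (rowWord P ++ [ x ]) ≡H rowWord P
ejectable-absorbed {r ∷ rs} {x} (lr ∷ _) (x∈r , inj₁ x-1∉r) = begin
  rowWord (r ∷ rs) ++ [ x ]   ≡⟨ cong (_++ [ x ]) (rowWord-∷ r rs) ⟩
  (rowWord rs ++ r) ++ [ x ]  ≡⟨ ++-assoc (rowWord rs) r [ x ] ⟩
  rowWord rs ++ r ++ [ x ]    ≈⟨ ++-congˡ (rowWord rs) (row-absorbs lr x∈r x-1∉r) ⟩
  rowWord rs ++ r             ≡⟨ rowWord-∷ r rs ⟨
  rowWord (r ∷ rs)            ∎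
  where open SetoidReasoning ≡H-setoid
ejectable-absorbed {P} {zero} _ e = ⊥-elim (¬Ejectable-0 P e)
ejectable-absorbed {r ∷ rs} {suc y} (lr ∷ lrs) (y+1∈r , inj₂ (y∈r , e)) = begin
  rowWord (r ∷ rs) ++ [ suc y ]   ≡⟨ cong (_++ [ suc y ]) (rowWord-∷ r rs) ⟩
  (rowWord rs ++ r) ++ [ suc y ]  ≡⟨ ++-assoc (rowWord rs) r [ suc y ] ⟩
  rowWord rs ++ r ++ [ suc y ]    ≈⟨ ++-congˡ (rowWord rs) (row-shifts lr y+1∈r y∈r) ⟩
  rowWord rs ++ y ∷ r             ≡⟨ ++-assoc (rowWord rs) [ y ] r ⟨
  (rowWord rs ++ [ y ]) ++ r      ≈⟨ ++-congʳ r (ejectable-absorbed lrs e) ⟩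
  rowWord rs ++ r                 ≡⟨ rowWord-∷ r rs ⟨
  rowWord (r ∷ rs)                ∎
  where open SetoidReasoning ≡H-setoid

lemma2p3 : (P : Tableau) (x : ℕ) → IsDecreasingTableau P → Ejectable P x →
    rowWord P ≡H (rowWord P ++ [ x ])
lemma2p3 P x (_ , _ , rows-decreasing , _) e = H-sym (ejectable-absorbed rows-decreasing e)
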